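{- Fix the setting below (an integer $k\ge2$, a $k$-connected graph $G$ on $n$ vertices, distinct vertices $v_1,\ldots,v_k$ of $G$, positive integers $n_1,\ldots,n_k$ with $n_1+\cdots+n_k<n$). Suppose there is an optimal configuration, with subgraphs $G_1,\ldots,G_k$, and an edge $ab$ of $G$ such that (1) either $a\in V(G_1)$ or $a$ belongs to $R(w)$ for some cascade vertex $w$, and (2) $b\in V(G_i)$ for some $i\in\{2,\ldots,k\}$, $b\neq v_i$, and $b$ does not belong to $R(w)$ for any cascade vertex $w$. Then the cascade of $G_i$ in this configuration is non-empty and $b$ is its last vertex.
   Context: Setting: $k\ge 2$ is an integer, $G$ is a finite simple $k$-connected graph on $n$ vertices, $v_1,\ldots,v_k$ are distinct vertices of $G$, and $n_1,\ldots,n_k$ are positive integers with $n_1+\cdots+n_k<n$. A "partition choice" is a tuple $G_1,\ldots,G_k$ of pairwise vertex-disjoint connected subgraphs of $G$ with $|V(G_i)|=n_i$ and $v_i\in V(G_i)$ for each $i$. Reservoir: for $i\in\{2,\ldots,k\}$ and $v\in V(G_i)$, the reservoir $R(v)$ is the set of all vertices of $G_i$ joined to $v_i$ by a path in $G_i\setminus v$ (so $v\notin R(v)$ and $R(v_i)=\emptyset$). Cascade: a cascade in $G_i$ ($i\ge2$) is a (possibly empty) sequence $w_1,\ldots,w_m$ of distinct vertices of $G_i\setminus v_i$ such that $w_{j+1}\notin R(w_j)$ for $j=1,\ldots,m-1$. Configuration: a partition choice $G_1,\ldots,G_k$ together with exactly one cascade in each $G_i$, $i=2,\ldots,k$. A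 cascade vertex is a vertex belonging to one of these cascades. Rank: for a cascade vertex $w\in V(G_i)$: if $w$ has a neighbor in $G_1$, its rank is $1$. Otherwise its rank is the least integer $r\ge2$ such that there is a cascade vertex $w'\in V(G_j)$ for some $j\in\{2,\ldots,k\}\setminus\{i\}$ with $w'$ of rank $r-1$ and $w$ having a neighbor in $R(w')$; if no such $r$ exists the rank of $w$ is undefined. For $r\ge1$, $\rho_r$ denotes the number of vertices belonging to $R(w)$ for some cascade vertex $w$ of rank $r$. Valid: a configuration is valid if every cascade vertex has a defined rank and, within each cascade $w_1,\ldots,w_m$, the ranks are strictly increasing ($\mathrm{rank}(w_a)<\mathrm{rank}(w_b)$ for $a<b$). For $r\ge1$, a valid configuration is $r$-optimal if among all valid configurations it lexicographically maximizes $(\rho_1,\rho_2,\ldots,\rho_r)$ (maximizes $\rho_1$, subject to that maximizes $\rho_2$, etc.). It is optimal if it is $r$-optimal for every $r\ge1$. -}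

module Defs where

open import Data.Nat using (ℕ; zero; suc; _≤_; _<_)
open import Data.Fin using (Fin)
open import Data.Fin.Subset using (Subset; _∈_; _∉_; ∣_∣; ∁; _-_)
open import Data.Bool using (Bool; T)
open import Data.List using (List)
open import Data.List.Membership.Propositional using () renaming (_∈_ to _∈ₗ_)
open import Data.List.Relation.Unary.Linked using (Linked)
open import Data.List.Relation.Unary.AllPairs using (AllPairs)
open import Data.List.Relation.Unary.All using (All)
open import Data.Product using (Σ; _×_; ∃; _,_)
open import Data.Sum using (_⊎_)
open import Data.Unit using (⊤)
open import Data.Empty using (⊥)
open import Relation.Nullary using (¬_)
open import Relation.Binary.PropositionalEquality using (_≡_; _≢_)
open import Function.Bundles using (_⇔_)

record Graph (n : ℕ) : Set where
  field
    adj   : Fin n → Fin n → Bool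
    sym   : ∀ x y → adj x y ≡ adj y x
    irrefl : ∀ x → adj x x ≡ Data.Bool.false

open Graph public

E : ∀ {n} → Graph n → Fin n → Fin n → Set
E G x y = T (adj G x y)

data PathIn {n} (G : Graph n) (P : Subset n) : Fin n → Fin n → Set where
  here : ∀ {x} → x ∈ P → PathIn G P x x
  step : ∀ {x y z} → x ∈ P → E G x y → PathIn G P y z → PathIn G P x z

ConnectedOn : ∀ {n} → Graph n → Subset n → Set
ConnectedOn G P = ∀ x y → x ∈ P → y ∈ P → PathIn G P x y

KConnected : ∀ {n} → Graph n → ℕ → Set
KConnected {n} G k =
  k < n × (∀ (S : Subset n) → ∣ S ∣ < k → ConnectedOn G (∁ S))

HasSize : ∀ {n} → (Fin n → Set) → ℕ → Set
HasSize {n} P c = Σ (Subset n) λ S → (∀ x → (x ∈ S) ⇔ P x) × ∣ S ∣ ≡ c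

-- Setting: k = suc m parts; part "1" is index zero, parts 2..k are
-- indices suc j for j : Fin m.

module Setting {n m : ℕ} (G : Graph n) (v : Fin (suc m) → Fin n)
                (ns : Fin (suc m) → ℕ) where

  -- partition choice: vertex sets of the (induced) subgraphs G_1..G_k
  record PartitionChoice : Set where
    field
      part      : Fin (suc m) → Subset n
      disjoint  : ∀ i j x → i ≢ j → x ∈ part i → x ∉ part j
      size      : ∀ i → ∣ part i ∣ ≡ ns i
      root      : ∀ i → v i ∈ part i
      connected : ∀ i → ConnectedOn G (part i)

  open PartitionChoice public

  Res : PartitionChoice → Fin m → Fin n → Fin n → Set
  Res P j w x = PathIn G (part P (Data.Fin.suc j) - w) x (v (Data.Fin.suc j))

  IsCascade : PartitionChoice → Fin m → List (Fin n) → Set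
  IsCascade P j ws =
    AllPairs _≢_ ws
    × All (λ w → w ∈ part P (Data.Fin.suc j) × w ≢ v (Data.Fin.suc j)) ws
    × Linked (λ a b → ¬ Res P j a b) ws

  record Config : Set where
    field
      pc       : PartitionChoice
      cascade  : Fin m → List (Fin n)
      isCasc   : ∀ j → IsCascade pc j (cascade j)

  open Config public

  module _ (C : Config) where

    private P = pc C

    CV : Fin m → Fin n → Set
    CV j w = w ∈ₗ cascade C j

    -- Cond r w : the condition defining "rank ≤ r" at level exactly r
    -- RankIs r w : w has rank r (least r with Cond r w)
    mutual
      Cond : ℕ → Fin n → Set
      Cond zero w = ⊥
      Cond (suc zero) w = ∃ λ x → x ∈ part P Data.Fin.zero × E G w x
      Cond (suc (suc r)) w =
        Σ (Fin m) λ i → Σ (Fin m) λ j → Σ (Fin n) λ w' → Σ (Fin n) λ x →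
          w ∈ part P (Data.Fin.suc i) × i ≢ j × CV j w'
          × RankIs (suc r) w' × Res P j w' x × E G w x

      Below : ℕ → Fin n → Set
      Below zero w = ⊤
      Below (suc r) w = Below r w × ¬ Cond r w

      RankIs : ℕ → Fin n → Set
      RankIs r w = Cond r w × Below r w

    Valid : Set
    Valid = ∀ j → All (λ w → ∃ λ r → RankIs r w) (cascade C j)
                × AllPairs (λ a b → ∀ r s → RankIs r a → RankIs s b → r < s)
                           (cascade C j)

    Rho : ℕ → ℕ → Set
    Rho r c = HasSize (λ x → Σ (Fin m) λ j → Σ (Fin n) λ w →
                         CV j w × RankIs r w × Res P j w x) c

    IsRhoSeq : (ℕ → ℕ) → Set
    IsRhoSeq ρ = ∀ r → 1 ≤ r → Rho r (ρ r)

  LexLE : (ℕ → ℕ) → (ℕ → ℕ) → ℕ → Set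
  LexLE f g r =
    (∀ i → 1 ≤ i → i ≤ r → f i ≡ g i)
    ⊎ (Σ ℕ λ i → 1 ≤ i × i ≤ r × f i < g i
                 × (∀ j → 1 ≤ j → j < i → f j ≡ g j))

  ROptimal : ℕ → Config → Set
  ROptimal r C = Valid C × Σ (ℕ → ℕ) λ ρ → IsRhoSeq C ρ
    × (∀ C' → Valid C' → ∀ ρ' → IsRhoSeq C' ρ' → LexLE ρ' ρ r)

  Optimal : Config → Set
  Optimal C = ∀ r → 1 ≤ r → ROptimal r C

-- If b is on cascade i it is last: its successor w would lie outside R(b), while b lies
-- outside R(w), yet a path from b to v_i inside G_i avoids one of b, w.  Otherwise the edge ab
-- gives b a rank r.  Keep the vertices of rank ≤ r of every cascade, but only those of rank < r
-- of cascade i, and append b to it.  This configuration is valid and has the same ranks up to r,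
-- so ρ_1, …, ρ_(r-1) do not change, while at rank r the reservoir R(b) swallows the reservoirs
-- of the dropped rank-r vertex of cascade i and also contains that vertex itself (or v_i, if
-- there was none): ρ_r strictly increases, contradicting optimality.
module Submission where

open import Defs
open import Data.Nat using (ℕ; zero; suc; _≤_; _<_; s≤s; z≤n; _<?_)
open import Data.Nat.ListAction using (sum)
open import Data.Bool using (T)
open import Data.Nat.Properties
  using ( <-cmp; <-irrefl; <-asym; ≤-refl; <⇒≤; ≤-pred; <⇒≱; ≮⇒≥; ≤-<-trans
        ; n<1+n; m<n⇒m<1+n; m≤n⇒m<n∨m≡n )
open import Data.Fin using (Fin; zero; suc; _≟_)
open import Data.Fin.Properties using (suc-injective)
open import Data.Fin.Subset using (Subset; _∈_; _∉_; _─_; _-_; ⁅_⁆; ∣_∣; inside; outside)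
  renaming (⊥ to ∅)
open import Data.Fin.Subset.Properties
  using (p─q⊆p; x∈p∧x≢y⇒x∈p-y; x∈⁅x⁆; drop-there; ∉⊥; ∣⊥∣≡0; p⊂q⇒∣p∣<∣q∣)
import Data.Vec.Base as Vec
open import Data.List using (List; []; _∷_; _++_; _∷ʳ_; tabulate)
open import Data.List.Membership.Propositional using () renaming (_∈_ to _∈ₗ_)
open import Data.List.Relation.Unary.Any using (here; there)
open import Data.List.Membership.Propositional.Properties using (∈-++⁺ˡ; ∈-++⁺ʳ; ∈-++⁻)
open import Data.List.Relation.Unary.All using (All; []; _∷_)
import Data.List.Relation.Unary.All as All
import Data.List.Relation.Unary.All.Properties as All
open import Data.List.Relation.Unary.AllPairs using (AllPairs; []; _∷_)
import Data.List.Relation.Unary.AllPairs.Properties as AllPairs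
open import Data.List.Relation.Unary.Linked using (Linked; []; [-]; _∷_)
open import Data.Product using (Σ; _×_; ∃; _,_; proj₁; proj₂)
open import Data.Sum using (_⊎_; inj₁; inj₂)
open import Data.Unit using (tt)
open import Data.Empty using (⊥; ⊥-elim)
open import Relation.Nullary using (¬_; Dec; yes; no)
open import Relation.Nullary.Decidable using (¬¬-excluded-middle)
open import Relation.Binary using (tri<; tri≈; tri>)
open import Relation.Binary.PropositionalEquality using (_≡_; _≢_; refl; cong; subst; subst₂; ≢-sym)
  renaming (sym to ≡-sym)
open import Function using (_∘_)
open import Function.Definitions using (Injective)
open import Function.Bundles using (_⇔_; mk⇔; Equivalence)
open import Function.Construct.Identity using (⇔-id)
open import Function.Construct.Composition using (_⇔-∘_)
open import Function.Related.TypeIsomorphisms using (¬-cong-⇔)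
open import Data.Product.Function.NonDependent.Propositional using (_×-⇔_)

x∈p─q⇒x∉q : ∀ {n} {x : Fin n} (p q : Subset n) → x ∈ p ─ q → x ∉ q
x∈p─q⇒x∉q (inside Vec.∷ p) (outside Vec.∷ q) Vec.here = λ ()
x∈p─q⇒x∉q (_ Vec.∷ p) (_ Vec.∷ q) (Vec.there x∈p─q) (Vec.there x∈q) =
  x∈p─q⇒x∉q p q x∈p─q x∈q

x∈p-y⁻ : ∀ {n} {x y : Fin n} {p : Subset n} → x ∈ p - y → x ∈ p × x ≢ y
x∈p-y⁻ {y = y} {p} x∈p-y =
  p─q⊆p p ⁅ y ⁆ x∈p-y , λ { refl → x∈p─q⇒x∉q p ⁅ y ⁆ x∈p-y (x∈⁅x⁆ y) }

Comprehension : ∀ {n} → (Fin n → Set) → Set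
Comprehension {n} P = Σ (Subset n) λ S → ∀ x → x ∈ S ⇔ P x

comprehension-∷ : ∀ {n} {P : Fin (suc n) → Set} →
                  Dec (P zero) → Comprehension (P ∘ suc) → Comprehension P
comprehension-∷ (yes p₀) (S , S⇔) = inside Vec.∷ S , λ
  { zero → mk⇔ (λ _ → p₀) (λ _ → Vec.here)
  ; (suc x) → mk⇔ (Equivalence.to (S⇔ x) ∘ drop-there) (Vec.there ∘ Equivalence.from (S⇔ x)) }
comprehension-∷ (no ¬p₀) (S , S⇔) = outside Vec.∷ S , λ
  { zero → mk⇔ (λ ()) (⊥-elim ∘ ¬p₀)
  ; (suc x) → mk⇔ (Equivalence.to (S⇔ x) ∘ drop-there) (Vec.there ∘ Equivalence.from (S⇔ x)) }

¬¬-comprehension : ∀ {n} (P : Fin n → Set) → ¬ ¬ Comprehension P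
¬¬-comprehension {zero} P k = k (Vec.[] , λ ())
¬¬-comprehension {suc n} P k = ¬¬-excluded-middle λ P₀? →
  ¬¬-comprehension (P ∘ suc) (k ∘ comprehension-∷ P₀?)

HasSize-cong : ∀ {n} {P Q : Fin n → Set} {c} → (∀ x → P x ⇔ Q x) → HasSize P c → HasSize Q c
HasSize-cong P⇔Q (S , S⇔P , |S|≡c) = S , (λ x → P⇔Q x ⇔-∘ S⇔P x) , |S|≡c

HasSize-empty : ∀ {n} {P : Fin n → Set} → (∀ x → ¬ P x) → HasSize P 0
HasSize-empty {n} ¬P = ∅ , (λ x → mk⇔ (⊥-elim ∘ ∉⊥) (⊥-elim ∘ ¬P x)) , ∣⊥∣≡0 n

Least : (ℕ → Set) → Set
Least Q = Σ ℕ λ r → Q r × (∀ {t} → t < r → ¬ Q t)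

¬¬-least : (Q : ℕ → Set) → ∀ r → Q r → ¬ ¬ Least Q
¬¬-least Q zero q k = k (zero , q , λ ())
¬¬-least Q (suc r) q k = ¬¬-excluded-middle λ
  { (yes q₀) → k (zero , q₀ , λ ())
  ; (no ¬q₀) → ¬¬-least (Q ∘ suc) r q λ (s , qs , below) →
      k (suc s , qs , λ { {zero} _ → ¬q₀ ; {suc t} (s≤s t<s) → below t<s }) }

module _ {n} (G : Graph n) where

  E-sym : ∀ {x y} → E G x y → E G y x
  E-sym {x} {y} = subst T (Graph.sym G x y)

  PathIn-source : ∀ {P x t} → PathIn G P x t → x ∈ P
  PathIn-source (here x∈P) = x∈P
  PathIn-source (step x∈P _ _) = x∈P

  -- Whichever of x, y the path visits last reaches t while avoiding the other.
  PathIn-trichotomy : ∀ {P x y s t} → x ≢ y → PathIn G P s t →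
    PathIn G (P - y) x t ⊎ PathIn G (P - x) y t
    ⊎ (PathIn G (P - x) s t × PathIn G (P - y) s t)
  PathIn-trichotomy {x = x} {y} x≢y (here {s} s∈P) with s ≟ x | s ≟ y
  ... | yes refl | _ = inj₁ (here (x∈p∧x≢y⇒x∈p-y s∈P x≢y))
  ... | no _ | yes refl = inj₂ (inj₁ (here (x∈p∧x≢y⇒x∈p-y s∈P (≢-sym x≢y))))
  ... | no s≢x | no s≢y =
    inj₂ (inj₂ (here (x∈p∧x≢y⇒x∈p-y s∈P s≢x) , here (x∈p∧x≢y⇒x∈p-y s∈P s≢y)))
  PathIn-trichotomy {x = x} {y} x≢y (step {s} s∈P e p) with PathIn-trichotomy x≢y p
  ... | inj₁ q = inj₁ q
  ... | inj₂ (inj₁ q) = inj₂ (inj₁ q)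
  ... | inj₂ (inj₂ (p∖x , p∖y)) with s ≟ x | s ≟ y
  ...   | yes refl | _ = inj₁ (step (x∈p∧x≢y⇒x∈p-y s∈P x≢y) e p∖y)
  ...   | no _ | yes refl = inj₂ (inj₁ (step (x∈p∧x≢y⇒x∈p-y s∈P (≢-sym x≢y)) e p∖x))
  ...   | no s≢x | no s≢y =
    inj₂ (inj₂ ( step (x∈p∧x≢y⇒x∈p-y s∈P s≢x) e p∖x
               , step (x∈p∧x≢y⇒x∈p-y s∈P s≢y) e p∖y ))

  PathIn-separate : ∀ {P x y t} → x ≢ y → PathIn G P x t →
                    PathIn G (P - y) x t ⊎ PathIn G (P - x) y t
  PathIn-separate x≢y p with PathIn-trichotomy x≢y p
  ... | inj₁ q = inj₁ q
  ... | inj₂ (inj₁ q) = inj₂ q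
  ... | inj₂ (inj₂ (p∖x , _)) = ⊥-elim (proj₂ (x∈p-y⁻ (PathIn-source p∖x)) refl)

  -- Every vertex on the path reaches t inside P - w, so none of them is b.
  PathIn-avoid : ∀ {P w b x t} → ¬ PathIn G (P - w) b t →
                 PathIn G (P - w) x t → PathIn G (P - b) x t
  PathIn-avoid ¬b p@(here x∈) =
    here (x∈p∧x≢y⇒x∈p-y (proj₁ (x∈p-y⁻ x∈)) λ { refl → ¬b p })
  PathIn-avoid ¬b p@(step x∈ e q) =
    step (x∈p∧x≢y⇒x∈p-y (proj₁ (x∈p-y⁻ x∈)) λ { refl → ¬b p }) e (PathIn-avoid ¬b q)

module _ {A : Set} where

  AllPairs-++⁻ˡ : ∀ {R : A → A → Set} xs {ys} → AllPairs R (xs ++ ys) → AllPairs R xs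
  AllPairs-++⁻ˡ [] _ = []
  AllPairs-++⁻ˡ (x ∷ xs) (Rx ∷ Rxs) = All.++⁻ˡ xs Rx ∷ AllPairs-++⁻ˡ xs Rxs

  Linked-++⁻ˡ : ∀ {R : A → A → Set} xs {ys} → Linked R (xs ++ ys) → Linked R xs
  Linked-++⁻ˡ [] _ = []
  Linked-++⁻ˡ (x ∷ []) _ = [-]
  Linked-++⁻ˡ (x ∷ y ∷ xs) (Rxy ∷ Rys) = Rxy ∷ Linked-++⁻ˡ (y ∷ xs) Rys

  Linked-∷ʳ⁺ : ∀ {R : A → A → Set} {xs b} →
               Linked R xs → All (λ x → R x b) xs → Linked R (xs ∷ʳ b)
  Linked-∷ʳ⁺ [] [] = [-]
  Linked-∷ʳ⁺ [-] (Rxb ∷ []) = Rxb ∷ [-]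
  Linked-∷ʳ⁺ (Rxy ∷ Rys) (_ ∷ Rysb) = Rxy ∷ Linked-∷ʳ⁺ Rys Rysb

  AllPairs-∷ʳ⁺ : ∀ {R : A → A → Set} {xs b} →
                 AllPairs R xs → All (λ x → R x b) xs → AllPairs R (xs ∷ʳ b)
  AllPairs-∷ʳ⁺ Rxs Rxsb = AllPairs.++⁺ Rxs ([] ∷ []) (All.map (_∷ []) Rxsb)

  AllPairs-zipWith-All : ∀ {P : A → Set} {R S : A → A → Set} →
    (∀ {x y} → P x → P y → R x y → S x y) →
    ∀ {xs} → All P xs → AllPairs R xs → AllPairs S xs
  AllPairs-zipWith-All f [] [] = []
  AllPairs-zipWith-All f (px ∷ pxs) (Rx ∷ Rxs) =
    All.zipWith (λ (py , Rxy) → f px py Rxy) (pxs , Rx) ∷ AllPairs-zipWith-All f pxs Rxs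

  AllPairs-related : ∀ {R : A → A → Set} {xs x y} → AllPairs R xs →
                     x ∈ₗ xs → y ∈ₗ xs → x ≢ y → R x y ⊎ R y x
  AllPairs-related (_ ∷ _) (here refl) (here refl) x≢y = ⊥-elim (x≢y refl)
  AllPairs-related (Rx ∷ _) (here refl) (there y∈) _ = inj₁ (All.lookup Rx y∈)
  AllPairs-related (Rx ∷ _) (there x∈) (here refl) _ = inj₂ (All.lookup Rx x∈)
  AllPairs-related (_ ∷ Rxs) (there x∈) (there y∈) x≢y = AllPairs-related Rxs x∈ y∈ x≢y

  last-or-linked : ∀ {R : A → A → Set} {xs b} → AllPairs _≢_ xs → Linked R xs → b ∈ₗ xs →
                   (∃ λ ws → xs ≡ ws ∷ʳ b) ⊎ (∃ λ w → w ∈ₗ xs × b ≢ w × R b w)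
  last-or-linked {xs = _ ∷ []} _ _ (here refl) = inj₁ ([] , refl)
  last-or-linked {xs = _ ∷ y ∷ _} ((b≢y ∷ _) ∷ _) (Rby ∷ _) (here refl) =
    inj₂ (y , there (here refl) , b≢y , Rby)
  last-or-linked {xs = x ∷ _} (_ ∷ distinct) (_ ∷ linked) (there b∈)
    with last-or-linked distinct linked b∈
  ... | inj₁ (ws , eq) = inj₁ (x ∷ ws , cong (x ∷_) eq)
  ... | inj₂ (w , w∈ , b≢w , Rbw) = inj₂ (w , there w∈ , b≢w , Rbw)

module RankCut {A : Set} (K : ℕ → A → Set) (K-unique : ∀ {r s x} → K r x → K s x → r ≡ s) where

  Ranked : List A → Set
  Ranked = All (λ x → ∃ λ s → K s x)

  Increasing : List A → Set
  Increasing = AllPairs (λ x y → ∀ r s → K r x → K s y → r < s)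

  record Cut (t : ℕ) (xs : List A) : Set where
    field
      front back  : List A
      split       : xs ≡ front ++ back
      front-below : All (λ x → ∃ λ s → K s x × s < t) front
      back-above  : All (λ x → ∀ s → K s x → t ≤ s) back

    ∈-front⁻ : ∀ {x} → x ∈ₗ front → x ∈ₗ xs
    ∈-front⁻ x∈ rewrite split = ∈-++⁺ˡ x∈

    ∈-front⁺ : ∀ {x s} → x ∈ₗ xs → K s x → s < t → x ∈ₗ front
    ∈-front⁺ {x} x∈ k s<t rewrite split with ∈-++⁻ front x∈
    ... | inj₁ x∈front = x∈front
    ... | inj₂ x∈back = ⊥-elim (<⇒≱ s<t (All.lookup back-above x∈back _ k))

  cut : ∀ t {xs} → Ranked xs → Increasing xs → Cut t xs
  cut t [] [] = record { front = [] ; back = [] ; split = refl ; front-below = [] ; back-above = [] }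
  cut t {x ∷ xs} ((s , k) ∷ ks) (x<xs ∷ inc) with s <? t
  ... | yes s<t = record
    { front = x ∷ front ; back = back ; split = cong (x ∷_) split
    ; front-below = (s , k , s<t) ∷ front-below ; back-above = back-above }
    where open Cut (cut t ks inc)
  ... | no s≮t = record
    { front = [] ; back = x ∷ xs ; split = refl ; front-below = []
    ; back-above = (λ s′ k′ → subst (t ≤_) (K-unique k k′) (≮⇒≥ s≮t))
                 ∷ All.map (λ x<y s′ k′ → <⇒≤ (≤-<-trans (≮⇒≥ s≮t) (x<y s s′ k k′))) x<xs
    }

module _ {n m} {G : Graph n} {v : Fin (suc m) → Fin n} {ns : Fin (suc m) → ℕ} where
  open Setting G v ns
  open import Data.List.Membership.DecPropositional (_≟_ {n}) using (_∈?_)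

  module _ (P : PartitionChoice) where

    part-unique : ∀ {i j x} → x ∈ part P i → x ∈ part P j → i ≡ j
    part-unique {i} {j} x∈i x∈j with i ≟ j
    ... | yes i≡j = i≡j
    ... | no i≢j = ⊥-elim (disjoint P i j _ i≢j x∈i x∈j)

    path-to-root : ∀ {k x} → x ∈ part P k → PathIn G (part P k) x (v k)
    path-to-root {k} x∈ = connected P k _ (v k) x∈ (root P k)

    Res⁻ : ∀ {j w x} → Res P j w x → x ∈ part P (suc j) × x ≢ w
    Res⁻ = x∈p-y⁻ ∘ PathIn-source G

    IsCascade-++⁻ˡ : ∀ {j} xs {ys} → IsCascade P j (xs ++ ys) → IsCascade P j xs
    IsCascade-++⁻ˡ xs (distinct , in-part , linked) =
      AllPairs-++⁻ˡ xs distinct , All.++⁻ˡ xs in-part , Linked-++⁻ˡ xs linked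

    IsCascade-∷ʳ⁺ : ∀ {j ws b} → IsCascade P j ws →
      b ∈ part P (suc j) → b ≢ v (suc j) → All (_≢ b) ws → All (λ w → ¬ Res P j w b) ws →
      IsCascade P j (ws ∷ʳ b)
    IsCascade-∷ʳ⁺ (distinct , in-part , linked) b∈ b≢v ws≢b ws↛b =
      AllPairs-∷ʳ⁺ distinct ws≢b , All.∷ʳ⁺ in-part (b∈ , b≢v) , Linked-∷ʳ⁺ linked ws↛b

    cascade-last : ∀ {j ws b} → IsCascade P j ws → b ∈ₗ ws →
                   (∀ {w} → w ∈ₗ ws → ¬ Res P j w b) → ∃ λ ws′ → ws ≡ ws′ ∷ʳ b
    cascade-last (distinct , in-part , linked) b∈ ws↛b with last-or-linked distinct linked b∈
    ... | inj₁ b-last = b-last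
    ... | inj₂ (w , w∈ , b≢w , w∉R[b])
      with PathIn-separate G b≢w (path-to-root (proj₁ (All.lookup in-part b∈)))
    ... | inj₁ b∈R[w] = ⊥-elim (ws↛b w∈ b∈R[w])
    ... | inj₂ w∈R[b] = ⊥-elim (w∉R[b] w∈R[b])

  Below⇒¬Cond : ∀ {C s w} → Below C s w → ∀ {t} → t < s → ¬ Cond C t w
  Below⇒¬Cond {s = suc s} (below , ¬cond) (s≤s t≤s) with m≤n⇒m<n∨m≡n t≤s
  ... | inj₁ t<s = Below⇒¬Cond below t<s
  ... | inj₂ refl = ¬cond

  ¬Cond⇒Below : ∀ {C} s {w} → (∀ {t} → t < s → ¬ Cond C t w) → Below C s w
  ¬Cond⇒Below zero _ = tt
  ¬Cond⇒Below (suc s) ¬cond = ¬Cond⇒Below s (¬cond ∘ m<n⇒m<1+n) , ¬cond (n<1+n s)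

  RankIs-unique : ∀ {C r s w} → RankIs C r w → RankIs C s w → r ≡ s
  RankIs-unique {r = r} {s} (cond-r , below-r) (cond-s , below-s) with <-cmp r s
  ... | tri< r<s _ _ = ⊥-elim (Below⇒¬Cond below-s r<s cond-r)
  ... | tri≈ _ r≡s _ = r≡s
  ... | tri> _ _ s<r = ⊥-elim (Below⇒¬Cond below-r s<r cond-s)

  RankIs-positive : ∀ {C r w} → RankIs C r w → 1 ≤ r
  RankIs-positive {r = suc _} _ = s≤s z≤n

  ¬¬-rank : ∀ {C r w} → Cond C r w → ¬ ¬ ∃ λ s → RankIs C s w
  ¬¬-rank {C} {r} {w} cond k =
    ¬¬-least (λ s → Cond C s w) r cond λ (s , cond-s , least) → k (s , cond-s , ¬Cond⇒Below s least)

  withCascades : (C : Config) (cs : Fin m → List (Fin n)) →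
                 (∀ j → IsCascade (pc C) j (cs j)) → Config
  withCascades C cs isCs = record { pc = pc C ; cascade = cs ; isCasc = isCs }

  module _ (C : Config) {cs : Fin m → List (Fin n)} {isCs : ∀ j → IsCascade (pc C) j (cs j)} (r : ℕ)
           (cascades-agree : ∀ {j w s} → s < r → RankIs C s w → w ∈ₗ cs j ⇔ w ∈ₗ cascade C j)
           where

    private
      C′ : Config
      C′ = withCascades C cs isCs

    mutual
      Cond-agree : ∀ s → s ≤ r → ∀ w → Cond C′ s w ⇔ Cond C s w
      Cond-agree zero _ w = ⇔-id _
      Cond-agree (suc zero) _ w = ⇔-id _
      Cond-agree (suc (suc s)) s<r w = mk⇔
        (λ (i , j , w′ , x , w∈ , i≢j , w′∈ , rank′ , res , e) →
           let rank = Equivalence.to (RankIs-agree (suc s) (<⇒≤ s<r) w′) rank′ in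
           i , j , w′ , x , w∈ , i≢j , Equivalence.to (cascades-agree s<r rank) w′∈ , rank , res , e)
        (λ (i , j , w′ , x , w∈ , i≢j , w′∈ , rank , res , e) →
           i , j , w′ , x , w∈ , i≢j , Equivalence.from (cascades-agree s<r rank) w′∈
           , Equivalence.from (RankIs-agree (suc s) (<⇒≤ s<r) w′) rank , res , e)

      Below-agree : ∀ s → s ≤ r → ∀ w → Below C′ s w ⇔ Below C s w
      Below-agree zero _ w = ⇔-id _
      Below-agree (suc s) s<r w =
        Below-agree s (<⇒≤ s<r) w ×-⇔ ¬-cong-⇔ (Cond-agree s (<⇒≤ s<r) w)

      RankIs-agree : ∀ s → s ≤ r → ∀ w → RankIs C′ s w ⇔ RankIs C s w
      RankIs-agree s s≤r w = Cond-agree s s≤r w ×-⇔ Below-agree s s≤r w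

  InRho : Config → ℕ → Fin n → Set
  InRho C s x = Σ (Fin m) λ j → Σ (Fin n) λ w → CV C j w × RankIs C s w × Res (pc C) j w x

  InRho-part : ∀ {C s i x} → x ∈ part (pc C) (suc i) → InRho C s x →
               ∃ λ w → CV C i w × RankIs C s w × Res (pc C) i w x
  InRho-part {C} x∈ (j , w , w∈ , rank , res)
    with suc-injective (part-unique (pc C) x∈ (proj₁ (Res⁻ (pc C) {j} res)))
  ... | refl = w , w∈ , rank , res

  LexLE-improvement : ∀ {f g r} → 1 ≤ r →
                      (∀ {s} → s < r → f s ≡ g s) → g r < f r → ¬ LexLE f g r
  LexLE-improvement r≥1 _ gr<fr (inj₁ equal) = <-irrefl (≡-sym (equal _ r≥1 ≤-refl)) gr<fr
  LexLE-improvement r≥1 agree gr<fr (inj₂ (t , _ , t≤r , ft<gt , _)) with m≤n⇒m<n∨m≡n t≤r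
  ... | inj₁ t<r = <-irrefl (agree t<r) ft<gt
  ... | inj₂ refl = <-asym ft<gt gr<fr

  -- The sizes demanded by IsRhoSeq exist only classically, so they can be produced under ¬¬ for
  -- one level only; the hypothesis that C′ has no rank above r makes all higher levels empty.
  ROptimal-unimprovable : ∀ {C C′ r} → 1 ≤ r → ROptimal r C → Valid C′ →
    (∀ {s} → s < r → ∀ x → InRho C s x ⇔ InRho C′ s x) →
    (∀ {s} → r < s → ∀ x → ¬ InRho C′ s x) →
    (∀ x → InRho C r x → InRho C′ r x) →
    (∃ λ x → InRho C′ r x × ¬ InRho C r x) → ⊥
  ROptimal-unimprovable {C} {C′} {r} r≥1 (_ , ρ , ρ-C , maximal) valid′ below above grows
                        (x , x∈′ , x∉) =
    ¬¬-comprehension (InRho C′ r) beaten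
    where
    beaten : Comprehension (InRho C′ r) → ⊥
    beaten (S′ , S′⇔) = LexLE-improvement r≥1 ρ′-below ρ<ρ′ (maximal C′ valid′ ρ′ ρ′-C′)
      where
      ρ′ : ℕ → ℕ
      ρ′ s with <-cmp s r
      ... | tri< _ _ _ = ρ s
      ... | tri≈ _ _ _ = ∣ S′ ∣
      ... | tri> _ _ _ = 0

      ρ′-C′ : IsRhoSeq C′ ρ′
      ρ′-C′ s s≥1 with <-cmp s r
      ... | tri< s<r _ _ = HasSize-cong (below s<r) (ρ-C s s≥1)
      ... | tri≈ _ refl _ = S′ , S′⇔ , refl
      ... | tri> _ _ r<s = HasSize-empty (above r<s)

      ρ′-below : ∀ {s} → s < r → ρ′ s ≡ ρ s
      ρ′-below {s} s<r with <-cmp s r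
      ... | tri< _ _ _ = refl
      ... | tri≈ s≮r _ _ = ⊥-elim (s≮r s<r)
      ... | tri> s≮r _ _ = ⊥-elim (s≮r s<r)

      ρ′-at : ρ′ r ≡ ∣ S′ ∣
      ρ′-at with <-cmp r r
      ... | tri< r<r _ _ = ⊥-elim (<-irrefl refl r<r)
      ... | tri≈ _ _ _ = refl
      ... | tri> _ _ r<r = ⊥-elim (<-irrefl refl r<r)

      ρ<ρ′ : ρ r < ρ′ r
      ρ<ρ′ with ρ-C r r≥1
      ... | S , S⇔ , |S|≡ρ =
        subst₂ _<_ |S|≡ρ (≡-sym ρ′-at) (p⊂q⇒∣p∣<∣q∣ (S⊆S′ , x , x∈S′ , x∉S))
        where
        S⊆S′ : ∀ {y} → y ∈ S → y ∈ S′
        S⊆S′ {y} = Equivalence.from (S′⇔ y) ∘ grows y ∘ Equivalence.to (S⇔ y)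
        x∈S′ : x ∈ S′
        x∈S′ = Equivalence.from (S′⇔ x) x∈′
        x∉S : x ∉ S
        x∉S = x∉ ∘ Equivalence.to (S⇔ x)

  Cond-of-neighbour : ∀ {C a b i} → Valid C → E G b a →
    a ∈ part (pc C) zero ⊎ Σ (Fin m) (λ j → Σ (Fin n) λ w → CV C j w × Res (pc C) j w a) →
    b ∈ part (pc C) (suc i) → ¬ CV C i b → (∀ {w} → CV C i w → ¬ Res (pc C) i w b) →
    ∃ λ r → Cond C r b
  Cond-of-neighbour {a = a} _ ba (inj₁ a∈G₁) _ _ _ = 1 , a , a∈G₁ , ba
  Cond-of-neighbour {C} {a} {b} {i} valid ba (inj₂ (j , w , w∈ , a∈R[w])) b∈Gᵢ b∉cascade b-outside
    with j ≟ i | All.lookup (proj₁ (valid j)) w∈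
  ... | no j≢i | suc s , rank =
    suc (suc s) , i , j , w , a , b∈Gᵢ , ≢-sym j≢i , w∈ , rank , a∈R[w] , ba
  ... | yes refl | _ with b ≟ w
  ...   | yes refl = ⊥-elim (b∉cascade w∈)
  ...   | no b≢w = ⊥-elim (b-outside w∈ (step (x∈p∧x≢y⇒x∈p-y b∈Gᵢ b≢w) ba a∈R[w]))

  module Truncation (C : Config) (valid : Valid C) {i : Fin m} {b : Fin n} {r : ℕ}
                    (b∈Gᵢ : b ∈ part (pc C) (suc i)) (b≢vᵢ : b ≢ v (suc i))
                    (b∉cascade : ¬ CV C i b) (b-outside : ∀ {w} → CV C i w → ¬ Res (pc C) i w b)
                    (rank-b : RankIs C r b) where

    open RankCut (RankIs C) RankIs-unique

    cut-at : ∀ t j → Cut t (cascade C j)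
    cut-at t j = cut t (proj₁ (valid j)) (proj₂ (valid j))

    front-isCascade : ∀ t j → IsCascade (pc C) j (Cut.front (cut-at t j))
    front-isCascade t j = IsCascade-++⁻ˡ (pc C) front (subst (IsCascade (pc C) j) split (isCasc C j))
      where open Cut (cut-at t j)

    front-increasing : ∀ t j → Increasing (Cut.front (cut-at t j))
    front-increasing t j = AllPairs-++⁻ˡ front (subst Increasing split (proj₂ (valid j)))
      where open Cut (cut-at t j)

    cascade′ : Fin m → List (Fin n)
    cascade′ j with j ≟ i
    ... | yes _ = Cut.front (cut-at r j) ∷ʳ b
    ... | no _ = Cut.front (cut-at (suc r) j)

    cascade′-isCascade : ∀ j → IsCascade (pc C) j (cascade′ j)
    cascade′-isCascade j with j ≟ i
    ... | yes refl = IsCascade-∷ʳ⁺ (pc C) (front-isCascade r i) b∈Gᵢ b≢vᵢ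
        (All.tabulate λ { w∈ refl → b∉cascade (∈-front⁻ w∈) })
        (All.tabulate (b-outside ∘ ∈-front⁻))
      where open Cut (cut-at r i)
    ... | no _ = front-isCascade (suc r) j

    C′ : Config
    C′ = withCascades C cascade′ cascade′-isCascade

    ∈-cascade′⁻ : ∀ j {w} → w ∈ₗ cascade′ j →
                  (w ∈ₗ cascade C j × ∃ λ s → RankIs C s w × s ≤ r) ⊎ w ≡ b
    ∈-cascade′⁻ j w∈ with j ≟ i
    ... | yes refl with ∈-++⁻ (Cut.front (cut-at r i)) w∈
    ...   | inj₂ (here w≡b) = inj₂ w≡b
    ...   | inj₁ w∈front with All.lookup (Cut.front-below (cut-at r i)) w∈front
    ...     | s , rank , s<r = inj₁ (Cut.∈-front⁻ (cut-at r i) w∈front , s , rank , <⇒≤ s<r)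
    ∈-cascade′⁻ j w∈ | no _ with All.lookup (Cut.front-below (cut-at (suc r) j)) w∈
    ... | s , rank , s<1+r = inj₁ (Cut.∈-front⁻ (cut-at (suc r) j) w∈ , s , rank , ≤-pred s<1+r)

    ∈-cascade′⁺ : ∀ j {w s} → w ∈ₗ cascade C j → RankIs C s w → s < r → w ∈ₗ cascade′ j
    ∈-cascade′⁺ j w∈ rank s<r with j ≟ i
    ... | yes refl = ∈-++⁺ˡ (Cut.∈-front⁺ (cut-at r j) w∈ rank s<r)
    ... | no _ = Cut.∈-front⁺ (cut-at (suc r) j) w∈ rank (m<n⇒m<1+n s<r)

    ∈-cascade′⁺-other : ∀ {j w s} → j ≢ i →
                        w ∈ₗ cascade C j → RankIs C s w → s ≤ r → w ∈ₗ cascade′ j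
    ∈-cascade′⁺-other {j} j≢i w∈ rank s≤r with j ≟ i
    ... | yes j≡i = ⊥-elim (j≢i j≡i)
    ... | no _ = Cut.∈-front⁺ (cut-at (suc r) j) w∈ rank (s≤s s≤r)

    b∈cascade′ : b ∈ₗ cascade′ i
    b∈cascade′ with i ≟ i
    ... | yes _ = ∈-++⁺ʳ (Cut.front (cut-at r i)) (here refl)
    ... | no i≢i = ⊥-elim (i≢i refl)

    cascades-agree : ∀ {j w s} → s < r → RankIs C s w → w ∈ₗ cascade′ j ⇔ w ∈ₗ cascade C j
    cascades-agree {j} s<r rank = mk⇔ to (λ w∈ → ∈-cascade′⁺ j w∈ rank s<r)
      where
      to : _ ∈ₗ cascade′ j → _ ∈ₗ cascade C j
      to w∈′ with ∈-cascade′⁻ j w∈′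
      ... | inj₁ (w∈ , _) = w∈
      ... | inj₂ refl = ⊥-elim (<-irrefl (RankIs-unique rank rank-b) s<r)

    rank′⇔rank : ∀ {s} → s ≤ r → ∀ w → RankIs C′ s w ⇔ RankIs C s w
    rank′⇔rank {s} = RankIs-agree C r cascades-agree s

    rank′-b : RankIs C′ r b
    rank′-b = Equivalence.from (rank′⇔rank ≤-refl b) rank-b

    rank′-bounded : ∀ j {w q} → w ∈ₗ cascade′ j → RankIs C′ q w → RankIs C q w × q ≤ r
    rank′-bounded j w∈′ rank′ with ∈-cascade′⁻ j w∈′
    ... | inj₁ (_ , s , rank , s≤r)
      with RankIs-unique rank′ (Equivalence.from (rank′⇔rank s≤r _) rank)
    ...   | refl = rank , s≤r
    rank′-bounded j w∈′ rank′ | inj₂ refl with RankIs-unique rank′ rank′-b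
    ...   | refl = rank-b , ≤-refl

    cascade′-increasing : ∀ j → Increasing (cascade′ j)
    cascade′-increasing j with j ≟ i
    ... | yes refl = AllPairs-∷ʳ⁺ (front-increasing r i) (All.map below-b (Cut.front-below (cut-at r i)))
      where
      below-b : ∀ {w} → (∃ λ s → RankIs C s w × s < r) →
                ∀ q q′ → RankIs C q w → RankIs C q′ b → q < q′
      below-b (s , rank , s<r) q q′ rank-q rank-q′
        rewrite RankIs-unique rank-q rank | RankIs-unique rank-q′ rank-b = s<r
    ... | no _ = front-increasing (suc r) j

    valid′ : Valid C′
    valid′ j = All.tabulate ranked , AllPairs-zipWith-All transfer bounded (cascade′-increasing j)
      where
      ranked : ∀ {w} → w ∈ₗ cascade′ j → ∃ λ s → RankIs C′ s w
      ranked w∈′ with ∈-cascade′⁻ j w∈′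
      ... | inj₁ (_ , s , rank , s≤r) = s , Equivalence.from (rank′⇔rank s≤r _) rank
      ... | inj₂ refl = r , rank′-b
      bounded : All (λ w → ∀ {q} → RankIs C′ q w → RankIs C q w) (cascade′ j)
      bounded = All.tabulate λ w∈′ → proj₁ ∘ rank′-bounded j w∈′
      transfer : ∀ {x y} →
                 (∀ {q} → RankIs C′ q x → RankIs C q x) → (∀ {q} → RankIs C′ q y → RankIs C q y) →
                 (∀ q q′ → RankIs C q x → RankIs C q′ y → q < q′) →
                 (∀ q q′ → RankIs C′ q x → RankIs C′ q′ y → q < q′)
      transfer back-x back-y increasing q q′ rank-x rank-y = increasing q q′ (back-x rank-x) (back-y rank-y)

    InRho-agree : ∀ {s} → s < r → ∀ x → InRho C s x ⇔ InRho C′ s x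
    InRho-agree s<r x = mk⇔
      (λ (j , w , w∈ , rank , res) →
         j , w , Equivalence.from (cascades-agree s<r rank) w∈
         , Equivalence.from (rank′⇔rank (<⇒≤ s<r) w) rank , res)
      (λ (j , w , w∈′ , rank′ , res) →
         let rank = Equivalence.to (rank′⇔rank (<⇒≤ s<r) w) rank′ in
         j , w , Equivalence.to (cascades-agree s<r rank) w∈′ , rank , res)

    InRho′-above : ∀ {s} → r < s → ∀ x → ¬ InRho C′ s x
    InRho′-above r<s x (j , w , w∈′ , rank′ , _) = <⇒≱ r<s (proj₂ (rank′-bounded j w∈′ rank′))

    InRho-grows : ∀ x → InRho C r x → InRho C′ r x
    InRho-grows x (j , w , w∈ , rank , x∈R[w]) with j ≟ i
    ... | yes refl = i , b , b∈cascade′ , rank′-b , PathIn-avoid G (b-outside w∈) x∈R[w]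
    ... | no j≢i =
      j , w , ∈-cascade′⁺-other j≢i w∈ rank ≤-refl
      , Equivalence.from (rank′⇔rank ≤-refl w) rank , x∈R[w]

    -- The new vertex: a rank-r vertex of cascade i if there is one, and v_i otherwise.
    InRho-grows-strictly : Dec (∃ λ w → CV C i w × RankIs C r w) →
                           ∃ λ x → InRho C′ r x × ¬ InRho C r x
    InRho-grows-strictly (yes (w , w∈ , rank)) = w , (i , b , b∈cascade′ , rank′-b , w∈R[b]) , w∉
      where
      w∈Gᵢ : w ∈ part (pc C) (suc i)
      w∈Gᵢ = proj₁ (All.lookup (proj₁ (proj₂ (isCasc C i))) w∈)
      w∈R[b] : Res (pc C) i b w
      w∈R[b] with PathIn-separate G (λ { refl → b∉cascade w∈ }) (path-to-root (pc C) w∈Gᵢ)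
      ... | inj₁ w∈R[b] = w∈R[b]
      ... | inj₂ b∈R[w] = ⊥-elim (b-outside w∈ b∈R[w])
      w∉ : ¬ InRho C r w
      w∉ w∈ρ with InRho-part {C} w∈Gᵢ w∈ρ
      ... | w″ , w″∈ , rank″ , w∈R[w″]
        with AllPairs-related (proj₂ (valid i)) w″∈ w∈ (≢-sym (proj₂ (Res⁻ (pc C) w∈R[w″])))
      ...   | inj₁ r<r = <-irrefl refl (r<r r r rank″ rank)
      ...   | inj₂ r<r = <-irrefl refl (r<r r r rank rank″)
    InRho-grows-strictly (no none) =
      v (suc i) , (i , b , b∈cascade′ , rank′-b , here vᵢ∈Gᵢ-b) , vᵢ∉
      where
      vᵢ∉ : ¬ InRho C r (v (suc i))
      vᵢ∉ vᵢ∈ρ with InRho-part {C} (root (pc C) (suc i)) vᵢ∈ρ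
      ... | w , w∈ , rank , _ = none (w , w∈ , rank)
      vᵢ∈Gᵢ-b : v (suc i) ∈ part (pc C) (suc i) - b
      vᵢ∈Gᵢ-b = x∈p∧x≢y⇒x∈p-y (root (pc C) (suc i)) (≢-sym b≢vᵢ)

  outside-vertex-unranked : ∀ {C i b r} → Optimal C →
    b ∈ part (pc C) (suc i) → b ≢ v (suc i) → ¬ CV C i b →
    (∀ {w} → CV C i w → ¬ Res (pc C) i w b) → ¬ RankIs C r b
  outside-vertex-unranked {C} {r = r} optimal b∈Gᵢ b≢vᵢ b∉cascade b-outside rank-b =
    ¬¬-excluded-middle λ rank-r-in-cascade? →
      ROptimal-unimprovable r≥1 (optimal r r≥1) valid′ InRho-agree InRho′-above InRho-grows
        (InRho-grows-strictly rank-r-in-cascade?)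
    where
    r≥1 : 1 ≤ r
    r≥1 = RankIs-positive rank-b
    open Truncation C (proj₁ (optimal 1 (s≤s z≤n))) b∈Gᵢ b≢vᵢ b∉cascade b-outside rank-b

  boundary-vertex-ends-cascade : ∀ {C a b i} → Optimal C → E G a b →
    a ∈ part (pc C) zero ⊎ Σ (Fin m) (λ j → Σ (Fin n) λ w → CV C j w × Res (pc C) j w a) →
    b ∈ part (pc C) (suc i) → b ≢ v (suc i) → (∀ {w} → CV C i w → ¬ Res (pc C) i w b) →
    ∃ λ ws → cascade C i ≡ ws ∷ʳ b
  boundary-vertex-ends-cascade {C} {b = b} {i} optimal ab a-source b∈Gᵢ b≢vᵢ b-outside
    with b ∈? cascade C i
  ... | yes b∈cascade = cascade-last (pc C) (isCasc C i) b∈cascade b-outside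
  ... | no b∉cascade = ⊥-elim (¬¬-rank (proj₂ cond-b) λ (_ , rank-b) →
          outside-vertex-unranked optimal b∈Gᵢ b≢vᵢ b∉cascade b-outside rank-b)
    where
    cond-b : ∃ λ r → Cond C r b
    cond-b = Cond-of-neighbour (proj₁ (optimal 1 (s≤s z≤n))) (E-sym G ab) a-source
                               b∈Gᵢ b∉cascade b-outside

lemma4 : ∀ {n m} (G : Graph n) → 1 ≤ m → KConnected G (suc m)
  → (v : Fin (suc m) → Fin n) → Injective _≡_ _≡_ v
  → (ns : Fin (suc m) → ℕ) → (∀ i → 1 ≤ ns i) → sum (tabulate ns) < n
  → let open Setting G v ns in
    (C : Config) → Optimal C
  → (a b : Fin n) → E G a b
  → (a ∈ part (pc C) zero
     ⊎ Σ (Fin m) (λ j → Σ (Fin n) (λ w →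
         w ∈ₗ cascade C j × Res (pc C) j w a)))
  → (i : Fin m) → b ∈ part (pc C) (Fin.suc i)
  → b ≢ v (Fin.suc i)
  → (∀ j w → w ∈ₗ cascade C j → ¬ Res (pc C) j w b)
  → ∃ λ (ws : List (Fin n)) → cascade C i ≡ ws ∷ʳ b
lemma4 G _ _ v _ ns _ _ C optimal a b ab a-source i b∈Gᵢ b≢vᵢ b-outside =
  boundary-vertex-ends-cascade optimal ab a-source b∈Gᵢ b≢vᵢ (b-outside i _)
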